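{- The free two-generated positive S4-algebra is infinite.
   Context: A positive S4-algebra is a structure $\langle A,\land,\lor,\Box,\Diamond,0,1\rangle$ such that $\langle A,\land,\lor,0,1\rangle$ is a bounded distributive lattice, $\Box 1=1$, $\Diamond 0=0$, and for all $a,b$: $\Box(a\land b)=\Box a\land\Box b$, $\Diamond(a\lor b)=\Diamond a\lor\Diamond b$, $\Box a\land\Diamond b\le\Diamond(a\land b)$, $\Box(a\lor b)\le\Box a\lor\Diamond b$, and $\Box\Box a=\Box a\le a\le\Diamond a=\Diamond\Diamond a$. -}

module Defs where

open import Data.Nat using (ℕ)
open import Data.Fin using (Fin)
open import Relation.Binary.PropositionalEquality using (_≡_)
open import Data.Product using (Σ)

infixr 7 _∧_
infixr 6 _∨_
data Term (n : ℕ) : Set where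
  var : Fin n → Term n
  _∧_ _∨_ : Term n → Term n → Term n
  □ ◇ : Term n → Term n
  𝟘 𝟙 : Term n

-- The equational theory of positive S4-algebras: the least congruence on
-- Term n containing all substitution instances of the defining identities.
-- (a ≤ b is encoded as the identity a ∧ b = a.)
-- The free positive S4-algebra on n generators is Term n modulo ⊢_≈_.
infix 4 ⊢_≈_
data ⊢_≈_ {n : ℕ} : Term n → Term n → Set where
  ≈-refl  : ∀ {a} → ⊢ a ≈ a
  ≈-sym   : ∀ {a b} → ⊢ a ≈ b → ⊢ b ≈ a
  ≈-trans : ∀ {a b c} → ⊢ a ≈ b → ⊢ b ≈ c → ⊢ a ≈ c
  ∧-cong : ∀ {a a' b b'} → ⊢ a ≈ a' → ⊢ b ≈ b' → ⊢ a ∧ b ≈ a' ∧ b'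
  ∨-cong : ∀ {a a' b b'} → ⊢ a ≈ a' → ⊢ b ≈ b' → ⊢ a ∨ b ≈ a' ∨ b'
  □-cong : ∀ {a a'} → ⊢ a ≈ a' → ⊢ □ a ≈ □ a'
  ◇-cong : ∀ {a a'} → ⊢ a ≈ a' → ⊢ ◇ a ≈ ◇ a'
  ∧-assoc : ∀ a b c → ⊢ (a ∧ b) ∧ c ≈ a ∧ (b ∧ c)
  ∨-assoc : ∀ a b c → ⊢ (a ∨ b) ∨ c ≈ a ∨ (b ∨ c)
  ∧-comm  : ∀ a b → ⊢ a ∧ b ≈ b ∧ a
  ∨-comm  : ∀ a b → ⊢ a ∨ b ≈ b ∨ a
  ∧-idem  : ∀ a → ⊢ a ∧ a ≈ a
  ∨-idem  : ∀ a → ⊢ a ∨ a ≈ a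
  ∧-absorbs-∨ : ∀ a b → ⊢ a ∧ (a ∨ b) ≈ a
  ∨-absorbs-∧ : ∀ a b → ⊢ a ∨ (a ∧ b) ≈ a
  ∧-distrib-∨ : ∀ a b c → ⊢ a ∧ (b ∨ c) ≈ (a ∧ b) ∨ (a ∧ c)
  ∧-identity : ∀ a → ⊢ a ∧ 𝟙 ≈ a
  ∨-identity : ∀ a → ⊢ a ∨ 𝟘 ≈ a
  □-𝟙 : ⊢ □ 𝟙 ≈ 𝟙
  ◇-𝟘 : ⊢ ◇ 𝟘 ≈ 𝟘
  □-∧ : ∀ a b → ⊢ □ (a ∧ b) ≈ □ a ∧ □ b
  ◇-∨ : ∀ a b → ⊢ ◇ (a ∨ b) ≈ ◇ a ∨ ◇ b
  □◇-≤ : ∀ a b → ⊢ (□ a ∧ ◇ b) ∧ ◇ (a ∧ b) ≈ □ a ∧ ◇ b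
  □∨-≤ : ∀ a b → ⊢ □ (a ∨ b) ∧ (□ a ∨ ◇ b) ≈ □ (a ∨ b)
  □□ : ∀ a → ⊢ □ (□ a) ≈ □ a
  □-≤ : ∀ a → ⊢ □ a ∧ a ≈ □ a
  ◇-≥ : ∀ a → ⊢ a ∧ ◇ a ≈ a
  ◇◇ : ∀ a → ⊢ ◇ (◇ a) ≈ ◇ a

InfiniteSetoid : (A : Set) → (A → A → Set) → Set
InfiniteSetoid A R = Σ (ℕ → A) λ f → ∀ i j → R (f i) (f j) → i ≡ j

-- Every finite preordered Kripke model, under an arbitrary valuation,
-- satisfies the positive S4 identities (finiteness makes truth decidable,
-- which the axiom □(a ∨ b) ≤ □a ∨ ◇b needs constructively).  In the chain
-- 0 ≤ 1 ≤ … ≤ m with p true at the even and q at the odd worlds, the term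
-- p ∧ ◇(q ∧ ◇(p ∧ …)) with n alternations holds at the bottom iff n ≤ m,
-- so these terms are pairwise separated by chain models.
module Submission where

open import Defs
open import Data.Nat as ℕ using (ℕ; zero; suc; _+_; _<_; s≤s; parity)
open import Data.Nat.Properties as ℕ using (+-identityʳ; +-suc; m≤n+m; n≤1+n; +-monoʳ-≤; ≤∧≢⇒<; ≤-antisym; module ≤-Reasoning)
open import Data.Fin as Fin using (Fin; toℕ; fromℕ<) renaming (zero to fzero; suc to fsuc)
open import Data.Fin.Properties as Finₚ using (any?; all?; toℕ≤pred[n]; toℕ-fromℕ<)
open import Data.Parity.Base using (Parity; 0ℙ; 1ℙ; _⁻¹)
open import Data.Parity.Properties as ℙ using (⁻¹-selfInverse; p≢p⁻¹; suc-homo-⁻¹)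
open import Data.Product using (Σ; _×_; _,_; proj₁; proj₂; swap)
open import Data.Product.Function.NonDependent.Propositional using (_×-⇔_)
open import Data.Sum using (_⊎_; inj₁; inj₂; [_,_]′) renaming (swap to swap⊎)
open import Data.Sum.Function.Propositional using (_⊎-⇔_)
open import Data.Empty using (⊥)
open import Data.Unit using (⊤; tt)
open import Function using (id; _∘_; _∘₂_)
open import Function.Bundles using (_⇔_; mk⇔; Equivalence)
open import Function.Construct.Identity using (⇔-id)
open import Function.Construct.Symmetry using (⇔-sym)
open import Function.Construct.Composition using (_⇔-∘_)
open import Level using (0ℓ)
open import Relation.Binary using (Rel; Reflexive; Transitive; Decidable)
open import Relation.Nullary using (Dec; yes; no)
open import Relation.Nullary.Decidable using (_×-dec_; _⊎-dec_; _→-dec_)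
open import Relation.Binary.PropositionalEquality using (_≡_; refl; sym; trans; cong; subst)

open Equivalence using (to; from)

→⇒×⇔ : {A B : Set} → (A → B) → (A × B) ⇔ A
→⇒×⇔ A⇒B = mk⇔ proj₁ (λ a → a , A⇒B a)

module KripkeModel
  {n k : ℕ}
  (_≼_ : Rel (Fin k) 0ℓ) (_≼?_ : Decidable _≼_)
  (≼-refl : Reflexive _≼_) (≼-trans : Transitive _≼_)
  (V : Fin n → Fin k → Set) (V? : ∀ x w → Dec (V x w))
  where

  infix 4 _⊨_
  _⊨_ : Fin k → Term n → Set
  w ⊨ var x = V x w
  w ⊨ a ∧ b = w ⊨ a × w ⊨ b
  w ⊨ a ∨ b = w ⊨ a ⊎ w ⊨ b
  w ⊨ □ a   = ∀ v → w ≼ v → v ⊨ a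
  w ⊨ ◇ a   = Σ (Fin k) λ v → w ≼ v × v ⊨ a
  w ⊨ 𝟘     = ⊥
  w ⊨ 𝟙     = ⊤

  ⊨-dec : ∀ w a → Dec (w ⊨ a)
  ⊨-dec w (var x) = V? x w
  ⊨-dec w (a ∧ b) = ⊨-dec w a ×-dec ⊨-dec w b
  ⊨-dec w (a ∨ b) = ⊨-dec w a ⊎-dec ⊨-dec w b
  ⊨-dec w (□ a)   = all? λ v → (w ≼? v) →-dec ⊨-dec v a
  ⊨-dec w (◇ a)   = any? λ v → (w ≼? v) ×-dec ⊨-dec v a
  ⊨-dec w 𝟘       = no λ ()
  ⊨-dec w 𝟙       = yes tt

  □∨⇒□⊎◇ : ∀ {w} a b → w ⊨ □ (a ∨ b) → w ⊨ □ a ⊎ w ⊨ ◇ b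
  □∨⇒□⊎◇ {w} a b □a∨b with ⊨-dec w (◇ b)
  ... | yes ◇b = inj₂ ◇b
  ... | no ¬◇b = inj₁ λ v w≼v → a-holds v w≼v (□a∨b v w≼v)
    where
    a-holds : ∀ v → w ≼ v → v ⊨ a ∨ b → v ⊨ a
    a-holds v _   (inj₁ a) = a
    a-holds v w≼v (inj₂ b) with () ← ¬◇b (v , w≼v , b)

  ⊨-sound : ∀ {a b} → ⊢ a ≈ b → ∀ w → w ⊨ a ⇔ w ⊨ b
  ⊨-sound ≈-refl w              = ⇔-id _
  ⊨-sound (≈-sym a≈b) w         = ⇔-sym (⊨-sound a≈b w)
  ⊨-sound (≈-trans a≈b b≈c) w   = ⊨-sound b≈c w ⇔-∘ ⊨-sound a≈b w
  ⊨-sound (∧-cong a≈a' b≈b') w  = ⊨-sound a≈a' w ×-⇔ ⊨-sound b≈b' w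
  ⊨-sound (∨-cong a≈a' b≈b') w  = ⊨-sound a≈a' w ⊎-⇔ ⊨-sound b≈b' w
  ⊨-sound (□-cong a≈a') w       = mk⇔ (λ □a v w≼v → to (⊨-sound a≈a' v) (□a v w≼v))
                                      (λ □a v w≼v → from (⊨-sound a≈a' v) (□a v w≼v))
  ⊨-sound (◇-cong a≈a') w       = mk⇔ (λ (v , w≼v , a) → v , w≼v , to (⊨-sound a≈a' v) a)
                                      (λ (v , w≼v , a) → v , w≼v , from (⊨-sound a≈a' v) a)
  ⊨-sound (∧-assoc a b c) w     = mk⇔ (λ ((x , y) , z) → x , y , z) (λ (x , y , z) → (x , y) , z)
  ⊨-sound (∨-assoc a b c) w     = mk⇔ [ [ inj₁ , inj₂ ∘ inj₁ ]′ , inj₂ ∘ inj₂ ]′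
                                      [ inj₁ ∘ inj₁ , [ inj₁ ∘ inj₂ , inj₂ ]′ ]′
  ⊨-sound (∧-comm a b) w        = mk⇔ swap swap
  ⊨-sound (∨-comm a b) w        = mk⇔ swap⊎ swap⊎
  ⊨-sound (∧-idem a) w          = →⇒×⇔ id
  ⊨-sound (∨-idem a) w          = mk⇔ [ id , id ]′ inj₁
  ⊨-sound (∧-absorbs-∨ a b) w   = →⇒×⇔ inj₁
  ⊨-sound (∨-absorbs-∧ a b) w   = mk⇔ [ id , proj₁ ]′ inj₁
  ⊨-sound (∧-distrib-∨ a b c) w = mk⇔ (λ { (x , inj₁ y) → inj₁ (x , y) ; (x , inj₂ z) → inj₂ (x , z) })
                                      [ (λ (x , y) → x , inj₁ y) , (λ (x , z) → x , inj₂ z) ]′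
  ⊨-sound (∧-identity a) w      = →⇒×⇔ (λ _ → tt)
  ⊨-sound (∨-identity a) w      = mk⇔ [ id , (λ ()) ]′ inj₁
  ⊨-sound □-𝟙 w                 = mk⇔ (λ _ → tt) (λ _ _ _ → tt)
  ⊨-sound ◇-𝟘 w                 = mk⇔ (λ ()) (λ ())
  ⊨-sound (□-∧ a b) w           = mk⇔ (λ □ab → proj₁ ∘₂ □ab , proj₂ ∘₂ □ab)
                                      (λ (□a , □b) v w≼v → □a v w≼v , □b v w≼v)
  ⊨-sound (◇-∨ a b) w           = mk⇔ (λ { (v , w≼v , inj₁ x) → inj₁ (v , w≼v , x) ; (v , w≼v , inj₂ y) → inj₂ (v , w≼v , y) })
                                      [ (λ (v , w≼v , x) → v , w≼v , inj₁ x) , (λ (v , w≼v , y) → v , w≼v , inj₂ y) ]′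
  ⊨-sound (□◇-≤ a b) w          = →⇒×⇔ λ (□a , v , w≼v , b) → v , w≼v , □a v w≼v , b
  ⊨-sound (□∨-≤ a b) w          = →⇒×⇔ (□∨⇒□⊎◇ a b)
  ⊨-sound (□□ a) w              = mk⇔ (λ □□a v w≼v → □□a v w≼v v ≼-refl)
                                      (λ □a v w≼v u v≼u → □a u (≼-trans w≼v v≼u))
  ⊨-sound (□-≤ a) w             = →⇒×⇔ λ □a → □a w ≼-refl
  ⊨-sound (◇-≥ a) w             = →⇒×⇔ λ a → w , ≼-refl , a
  ⊨-sound (◇◇ a) w              = mk⇔ (λ (v , w≼v , u , v≼u , x) → u , ≼-trans w≼v v≼u , x)
                                      (λ (v , w≼v , x) → v , w≼v , v , ≼-refl , x)

parity-suc : ∀ {π} n → parity n ≡ π → parity (suc n) ≡ π ⁻¹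
parity-suc n parity-n = sym (⁻¹-selfInverse (trans (suc-homo-⁻¹ n) parity-n))

≤∧parity-flip⇒< : ∀ {π i j} → i ℕ.≤ j → parity i ≡ π → parity j ≡ π ⁻¹ → i < j
≤∧parity-flip⇒< {π} i≤j parity-i parity-j =
  ≤∧≢⇒< i≤j λ i≡j → p≢p⁻¹ π (trans (sym parity-i) (trans (cong parity i≡j) parity-j))

atom : Parity → Term 2
atom 0ℙ = var fzero
atom 1ℙ = var (fsuc fzero)

alternating : Parity → ℕ → Term 2
alternating π zero    = atom π
alternating π (suc n) = atom π ∧ ◇ (alternating (π ⁻¹) n)

module Chain (m : ℕ) where

  open KripkeModel {2} {suc m} Fin._≤_ Finₚ._≤?_ Finₚ.≤-refl Finₚ.≤-trans
    (λ x w → parity (toℕ w) ≡ parity (toℕ x)) (λ x w → parity (toℕ w) ℙ.≟ parity (toℕ x)) public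

  ⊨-atom : ∀ π w → w ⊨ atom π ⇔ parity (toℕ w) ≡ π
  ⊨-atom 0ℙ w = ⇔-id _
  ⊨-atom 1ℙ w = ⇔-id _

  ⊨alternating⇒parity : ∀ π n w → w ⊨ alternating π n → parity (toℕ w) ≡ π
  ⊨alternating⇒parity π zero    w w⊨atom       = to (⊨-atom π w) w⊨atom
  ⊨alternating⇒parity π (suc n) w (w⊨atom , _) = to (⊨-atom π w) w⊨atom

  ⊨alternating⇒≤ : ∀ π n w → w ⊨ alternating π n → n + toℕ w ℕ.≤ m
  ⊨alternating⇒≤ π zero    w _ = toℕ≤pred[n] w
  ⊨alternating⇒≤ π (suc n) w (w⊨atom , v , w≤v , v⊨alt) = begin
    suc n + toℕ w   ≡⟨ +-suc n (toℕ w) ⟨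
    n + suc (toℕ w) ≤⟨ +-monoʳ-≤ n w<v ⟩
    n + toℕ v       ≤⟨ ⊨alternating⇒≤ (π ⁻¹) n v v⊨alt ⟩
    m               ∎
    where
    open ≤-Reasoning
    w<v : toℕ w < toℕ v
    w<v = ≤∧parity-flip⇒< w≤v (to (⊨-atom π w) w⊨atom) (⊨alternating⇒parity (π ⁻¹) n v v⊨alt)

  ≤⇒⊨alternating : ∀ π n w → parity (toℕ w) ≡ π → n + toℕ w ℕ.≤ m → w ⊨ alternating π n
  ≤⇒⊨alternating π zero    w parity-w _ = from (⊨-atom π w) parity-w
  ≤⇒⊨alternating π (suc n) w parity-w 1+n+w≤m =
    from (⊨-atom π w) parity-w , v , w≤v , ≤⇒⊨alternating (π ⁻¹) n v parity-v n+v≤m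
    where
    open ≤-Reasoning
    w<m : toℕ w < m
    w<m = ℕ.≤-trans (s≤s (m≤n+m (toℕ w) n)) 1+n+w≤m
    v : Fin (suc m)
    v = fromℕ< (s≤s w<m)
    toℕ-v : toℕ v ≡ suc (toℕ w)
    toℕ-v = toℕ-fromℕ< (s≤s w<m)
    w≤v : toℕ w ℕ.≤ toℕ v
    w≤v = ℕ.≤-trans (n≤1+n (toℕ w)) (ℕ.≤-reflexive (sym toℕ-v))
    parity-v : parity (toℕ v) ≡ π ⁻¹
    parity-v = subst (λ i → parity i ≡ π ⁻¹) (sym toℕ-v) (parity-suc (toℕ w) parity-w)
    n+v≤m : n + toℕ v ℕ.≤ m
    n+v≤m = begin
      n + toℕ v       ≡⟨ cong (n +_) toℕ-v ⟩
      n + suc (toℕ w) ≡⟨ +-suc n (toℕ w) ⟩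
      suc n + toℕ w   ≤⟨ 1+n+w≤m ⟩
      m               ∎

  bottom⊨alternating⇔≤ : ∀ n → fzero ⊨ alternating 0ℙ n ⇔ n ℕ.≤ m
  bottom⊨alternating⇔≤ n = mk⇔
    (λ bottom⊨ → subst (ℕ._≤ m) (+-identityʳ n) (⊨alternating⇒≤ 0ℙ n fzero bottom⊨))
    (λ n≤m → ≤⇒⊨alternating 0ℙ n fzero refl (subst (ℕ._≤ m) (sym (+-identityʳ n)) n≤m))

⊢alternating≈⇒≤ : ∀ {i j} → ⊢ alternating 0ℙ i ≈ alternating 0ℙ j → i ℕ.≤ j
⊢alternating≈⇒≤ {i} {j} i≈j =
  to (bottom⊨alternating⇔≤ i) (from (⊨-sound i≈j fzero) (from (bottom⊨alternating⇔≤ j) ℕ.≤-refl))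
  where open Chain j

lemma5p3 : InfiniteSetoid (Term 2) ⊢_≈_
lemma5p3 = alternating 0ℙ , λ i j i≈j → ≤-antisym (⊢alternating≈⇒≤ i≈j) (⊢alternating≈⇒≤ (≈-sym i≈j))
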